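{- Let $4\le k\le n/3$ with $(3k-3)$ dividing $n$, and let $U$ be the set of permutations defined below. Each permutation in $U$ can be partitioned into $\frac{kn}{3k-3}$ decreasing subsequences in exactly one way, and for two different permutations in $U$ these unique partitions (of the position set $\{1,\dots,n\}$) are different.
   Context: For integers $N\ge 2\ell\ge2$, let $\Gamma_{N,\ell}$ be the following set of permutations of $\{1,\dots,N\}$: for every partition $P_1,\dots,P_\ell$ of positions $\{1,\dots,N\}$ in which positions $i$ and $N-\ell+i$ belong to $P_i$ for each $1\le i\le\ell$ and each position in $\{\ell+1,\dots,N-\ell\}$ is placed in an arbitrary part, take the unique permutation whose values on each $P_i$ decrease with position and such that every value on $P_i$ is smaller than every value on $P_{i+1}$ ($1\le i\le\ell-1$). The set $U$ consists of the permutations $(x_1,\dots,x_n)$ of $\{1,\dots,n\}$ obtained as follows: split the positions into $\frac{n}{3k-3}$ consecutive blocks of length $3k-3$; for $0\le t<\frac{n}{3k-3}$, the $t$-th block $(x_{t(3k-3)+1},\dots,x_{(t+1)(3k-3)})$ takes exactly the values $\{t(3k-3)+1,\dots,(t+1)(3k-3)\}$, arranged in the relative order of some (independently chosen) permutation from $\Gamma_{3k-3,k}$. A partition into decreasing subsequences is a partition of the positions into classes whose values, read in increasing order of positions, are decreasing. -}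

module Defs where

open import Data.Nat using (ℕ; zero; suc; _+_; _*_; _∸_; _≤_; _<_)
open import Data.Fin using (Fin; toℕ; fromℕ<)
open import Data.Product using (Σ; ∃; _×_)
open import Relation.Binary.PropositionalEquality using (_≡_)
open import Function.Definitions using (Injective)

-- Conventions: positions and values are 0-indexed (Fin N); the paper's
-- position/value x corresponds to x - 1 here.  A permutation of {1..N} is an
-- injective map Fin N → Fin N (hence a bijection).

-- The partition P_1..P_ℓ of positions is given by a
-- labelling p : Fin N → Fin ℓ (P_{i+1} = p⁻¹(i), 0-indexed labels).
InΓ : (N ℓ : ℕ) → (Fin N → Fin N) → Set
InΓ N ℓ σ =
  Injective _≡_ _≡_ σ ×
  Σ (Fin N → Fin ℓ) λ p →
    (∀ (i : Fin N) → toℕ i < ℓ → toℕ (p i) ≡ toℕ i) ×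
    (∀ (i : Fin N) → N ∸ ℓ ≤ toℕ i → toℕ (p i) + (N ∸ ℓ) ≡ toℕ i) ×
    (∀ (a b : Fin N) → p a ≡ p b → toℕ a < toℕ b → toℕ (σ b) < toℕ (σ a)) ×
    (∀ (a b : Fin N) → toℕ (p b) ≡ suc (toℕ (p a)) → toℕ (σ a) < toℕ (σ b))

-- Membership in U (for parameters k, n): blocks of length M = 3k-3; block t
-- (positions t*M .. t*M+M-1) takes values t*M .. t*M+M-1 arranged in the
-- relative order of some σ t ∈ Γ_{M,k}.
InU : (k n : ℕ) → (Fin n → Fin n) → Set
InU k n π =
  Injective _≡_ _≡_ π ×
  Σ (ℕ → Fin (3 * k ∸ 3) → Fin (3 * k ∸ 3)) λ σ →
    (∀ (t : ℕ) → t * (3 * k ∸ 3) < n → InΓ (3 * k ∸ 3) k (σ t)) ×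
    (∀ (t : ℕ) (r : Fin (3 * k ∸ 3)) (h : t * (3 * k ∸ 3) + toℕ r < n) →
       toℕ (π (fromℕ< h)) ≡ t * (3 * k ∸ 3) + toℕ (σ t r))

-- A partition of the positions into exactly m classes, given by a surjective
-- class labelling c : Fin n → Fin m (all m classes nonempty).
Surj : {n m : ℕ} → (Fin n → Fin m) → Set
Surj {n} {m} c = ∀ (y : Fin m) → ∃ λ (x : Fin n) → c x ≡ y

DecPartition : {n : ℕ} (m : ℕ) → (Fin n → Fin n) → (Fin n → Fin m) → Set
DecPartition {n} m π c =
  Surj c ×
  (∀ (i j : Fin n) → toℕ i < toℕ j → c i ≡ c j → toℕ (π j) < toℕ (π i))

SamePartition : {n m m' : ℕ} → (Fin n → Fin m) → (Fin n → Fin m') → Set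
SamePartition {n} c c' =
  ∀ (i j : Fin n) → (c i ≡ c j → c' i ≡ c' j) × (c' i ≡ c' j → c i ≡ c j)

-- Each block of a permutation in U is a copy of some σ ∈ Γ_{3k-3,k}, and the blocks increase
-- relative to each other. A class of a decreasing partition never contains both entries of an
-- increasing pair. Through every position r there is an increasing subsequence of length kq: in
-- each block take the left anchor (position i) of every part below that of r, then r, then the
-- right anchors (position 3k-3-k+i) of the parts above. Each of the kq classes therefore meets it
-- exactly once; the left anchor of r's part forms an increasing pair with every other entry of it,
-- so it lies in the class of r. Thus the classes are exactly the parts of the blocks. Finally σ ∈ Γ
-- is determined by its parts, since σ a < σ b iff a lies in a lower part, or in the same part as b
-- and after it.

module Submission where

open import Defs
open import Data.Nat as ℕ using (ℕ; zero; suc; _+_; _*_; _∸_; _≤_; z≤n)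
import Data.Nat.Properties as ℕ
open import Data.Nat.Divisibility using (_∣_; divides)
open import Data.Fin using (Fin; toℕ; fromℕ<; inject≤; combine; remQuot; punchOut; _<_)
open import Data.Fin.Properties
  using ( _≟_; <-cmp; <-asym; <-irrefl; <-trans; toℕ-injective; toℕ-fromℕ<; toℕ-inject≤
        ; toℕ<n; toℕ-combine; combine-monoˡ-<; combine-injective; combine-remQuot
        ; remQuot-combine; combine-surjective; any?; punchOut-injective; injective⇒≤ )
open import Data.Product using (∃; _×_; _,_; proj₁; proj₂; uncurry)
open import Data.Sum using (_⊎_; inj₁; inj₂)
import Data.Sum as Sum
open import Function using (_∘_)
open import Function.Definitions using (Injective)
open import Relation.Binary.Definitions using (tri<; tri≈; tri>)
open import Relation.Binary.PropositionalEquality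
open import Relation.Nullary using (¬_; yes; no; contradiction)

injective⇒surjective : ∀ {m n} {f : Fin m → Fin n} → n ≤ m → Injective _≡_ _≡_ f →
                       ∀ y → ∃ λ x → f x ≡ y
injective⇒surjective {n = suc _} {f} n≤m f-injective y with any? (λ x → f x ≟ y)
... | yes hit = hit
... | no miss = contradiction (injective⇒≤ punchOut-f-injective) (ℕ.<⇒≱ n≤m)
  where
  y≢f : ∀ x → y ≢ f x
  y≢f x y≡fx = miss (x , sym y≡fx)

  punchOut-f-injective : Injective _≡_ _≡_ (λ x → punchOut (y≢f x))
  punchOut-f-injective eq = f-injective (punchOut-injective (y≢f _) (y≢f _) eq)

toℕ-combine′ : ∀ {m n} (i : Fin m) (j : Fin n) → toℕ (combine i j) ≡ toℕ i * n + toℕ j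
toℕ-combine′ {n = n} i j = trans (toℕ-combine i j) (cong (_+ toℕ j) (ℕ.*-comm n (toℕ i)))

combine-monoʳ-< : ∀ {m n} (i : Fin m) {j k : Fin n} → j < k → combine i j < combine i k
combine-monoʳ-< {n = n} i {j} {k} j<k = subst₂ ℕ._<_ (sym (toℕ-combine i j)) (sym (toℕ-combine i k))
  (ℕ.+-monoʳ-< (n * toℕ i) j<k)

combine-cancelˡ-< : ∀ {m n} (i : Fin m) {j k : Fin n} → combine i j < combine i k → j < k
combine-cancelˡ-< {n = n} i {j} {k} ij<ik = ℕ.+-cancelˡ-< (n * toℕ i) _ _
  (subst₂ ℕ._<_ (toℕ-combine i j) (toℕ-combine i k) ij<ik)

remQuot-injective : ∀ {m} n {i j : Fin (m * n)} → remQuot {m} n i ≡ remQuot n j → i ≡ j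
remQuot-injective {m} n {i} {j} eq =
  trans (sym (combine-remQuot {m} n i))
        (trans (cong (uncurry combine) eq) (combine-remQuot {m} n j))

≤-of-order-preserving : ∀ {N} {σ σ' : Fin N → Fin N} → (∀ y → ∃ λ x → σ x ≡ y) →
                        (∀ {a b} → σ a < σ b → σ' a < σ' b) →
                        ∀ a → toℕ (σ a) ≤ toℕ (σ' a)
≤-of-order-preserving {N} {σ} {σ'} σ-surjective preserves a = below (toℕ (σ a)) a refl
  where
  below : ∀ v a → toℕ (σ a) ≡ v → v ≤ toℕ (σ' a)
  below zero    a _  = z≤n
  below (suc w) a σa≡1+w = ℕ.≤-<-trans (below w b σb≡w) (preserves σb<σa)
    where
    w<N : w ℕ.< N
    w<N = ℕ.<-trans (ℕ.n<1+n w) (subst (ℕ._< N) σa≡1+w (toℕ<n (σ a)))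
    b : Fin N
    b = proj₁ (σ-surjective (fromℕ< w<N))
    σb≡w : toℕ (σ b) ≡ w
    σb≡w = trans (cong toℕ (proj₂ (σ-surjective (fromℕ< w<N)))) (toℕ-fromℕ< w<N)
    σb<σa : σ b < σ a
    σb<σa = subst₂ ℕ._<_ (sym σb≡w) (sym σa≡1+w) (ℕ.n<1+n w)

same-order⇒≗ : ∀ {N} {σ σ' : Fin N → Fin N} → Injective _≡_ _≡_ σ → Injective _≡_ _≡_ σ' →
               (∀ {a b} → σ a < σ b → σ' a < σ' b) → (∀ {a b} → σ' a < σ' b → σ a < σ b) →
               σ ≗ σ'
same-order⇒≗ σ-injective σ'-injective to from a = toℕ-injective (ℕ.≤-antisym
  (≤-of-order-preserving (injective⇒surjective ℕ.≤-refl σ-injective) to a)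
  (≤-of-order-preserving (injective⇒surjective ℕ.≤-refl σ'-injective) from a))

module _ {n : ℕ} (π : Fin n → Fin n) where

  Ascending : Fin n → Fin n → Set
  Ascending a b = a < b × π a < π b

  Separated : Fin n → Fin n → Set
  Separated a b = Ascending a b ⊎ Ascending b a

ascending⇒separated : ∀ {m n} {π : Fin n → Fin n} {f : Fin m → Fin n} →
                      (∀ {i j} → i < j → Ascending π (f i) (f j)) →
                      ∀ {i j} → i ≢ j → Separated π (f i) (f j)
ascending⇒separated ascending {i} {j} i≢j with <-cmp i j
... | tri< i<j _ _ = inj₁ (ascending i<j)
... | tri≈ _ i≡j _ = contradiction i≡j i≢j
... | tri> _ _ j<i = inj₂ (ascending j<i)

module _ {m n : ℕ} {π : Fin n → Fin n} {c : Fin n → Fin m} (dp : DecPartition m π c) where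

  separated⇒different-classes : ∀ {a b} → Separated π a b → c a ≢ c b
  separated⇒different-classes (inj₁ (a<b , πa<πb)) ca≡cb =
    <-asym πa<πb (proj₂ dp _ _ a<b ca≡cb)
  separated⇒different-classes (inj₂ (b<a , πb<πa)) ca≡cb =
    <-asym πb<πa (proj₂ dp _ _ b<a (sym ca≡cb))

  module _ {m' : ℕ} {L : Fin m' → Fin n}
           (L-separated : ∀ {i j} → i ≢ j → Separated π (L i) (L j)) where

    classes-of-separated-family-injective : Injective _≡_ _≡_ (c ∘ L)
    classes-of-separated-family-injective {i} {j} same with i ≟ j
    ... | yes i≡j = i≡j
    ... | no  i≢j = contradiction same (separated⇒different-classes (L-separated i≢j))

    separated-family-meets-every-class : m ≤ m' → ∀ y → ∃ λ i → c (L i) ≡ y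
    separated-family-meets-every-class m≤m' =
      injective⇒surjective m≤m' classes-of-separated-family-injective

    class-of-point-separated-from-family : m ≤ m' → ∀ x i →
      (∀ j → j ≢ i → Separated π x (L j)) → c x ≡ c (L i)
    class-of-point-separated-from-family m≤m' x i x-separated
      with separated-family-meets-every-class m≤m' (c x)
    ... | j , cLj≡cx with j ≟ i
    ...   | yes refl = sym cLj≡cx
    ...   | no  j≢i  = contradiction (sym cLj≡cx) (separated⇒different-classes (x-separated j j≢i))

Precedes : ∀ {N ℓ} → (Fin N → Fin ℓ) → Fin N → Fin N → Set
Precedes part a b = part a < part b ⊎ (part a ≡ part b × b < a)

module Anchors {N ℓ : ℕ} (ℓ+ℓ≤N : ℓ + ℓ ≤ N) where

  anchorˡ : Fin ℓ → Fin N
  anchorˡ i = inject≤ i (ℕ.m+n≤o⇒m≤o ℓ ℓ+ℓ≤N)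

  toℕ-anchorˡ : ∀ i → toℕ (anchorˡ i) ≡ toℕ i
  toℕ-anchorˡ i = toℕ-inject≤ i _

  anchorʳ< : ∀ (i : Fin ℓ) → N ∸ ℓ + toℕ i ℕ.< N
  anchorʳ< i = subst (N ∸ ℓ + toℕ i ℕ.<_) (ℕ.m∸n+n≡m (ℕ.m+n≤o⇒m≤o ℓ ℓ+ℓ≤N))
                     (ℕ.+-monoʳ-< (N ∸ ℓ) (toℕ<n i))

  anchorʳ : Fin ℓ → Fin N
  anchorʳ i = fromℕ< (anchorʳ< i)

  toℕ-anchorʳ : ∀ i → toℕ (anchorʳ i) ≡ N ∸ ℓ + toℕ i
  toℕ-anchorʳ i = toℕ-fromℕ< (anchorʳ< i)

  anchorˡ<anchorʳ : ∀ i j → anchorˡ i < anchorʳ j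
  anchorˡ<anchorʳ i j = subst₂ ℕ._<_ (sym (toℕ-anchorˡ i)) (sym (toℕ-anchorʳ j))
    (ℕ.<-≤-trans (toℕ<n i) (ℕ.≤-trans (ℕ.m+n≤o⇒m≤o∸n ℓ ℓ+ℓ≤N) (ℕ.m≤m+n (N ∸ ℓ) (toℕ j))))

module Γ-properties {N ℓ : ℕ} (ℓ+ℓ≤N : ℓ + ℓ ≤ N) {σ : Fin N → Fin N} (γ : InΓ N ℓ σ) where
  open Anchors {N} {ℓ} ℓ+ℓ≤N

  part : Fin N → Fin ℓ
  part = proj₁ (proj₂ γ)

  private
    part-low : ∀ a → toℕ a ℕ.< ℓ → toℕ (part a) ≡ toℕ a
    part-low = proj₁ (proj₂ (proj₂ γ))

    part-high : ∀ a → N ∸ ℓ ≤ toℕ a → toℕ (part a) + (N ∸ ℓ) ≡ toℕ a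
    part-high = proj₁ (proj₂ (proj₂ (proj₂ γ)))

    adjacent-parts : ∀ a b → toℕ (part b) ≡ suc (toℕ (part a)) → σ a < σ b
    adjacent-parts = proj₂ (proj₂ (proj₂ (proj₂ (proj₂ γ))))

  decreasing-within-part : ∀ {a b} → part a ≡ part b → a < b → σ b < σ a
  decreasing-within-part = proj₁ (proj₂ (proj₂ (proj₂ (proj₂ γ)))) _ _

  part-anchorˡ : ∀ i → part (anchorˡ i) ≡ i
  part-anchorˡ i = toℕ-injective (trans (part-low (anchorˡ i) anchorˡ<ℓ) (toℕ-anchorˡ i))
    where
    anchorˡ<ℓ : toℕ (anchorˡ i) ℕ.< ℓ
    anchorˡ<ℓ = subst (ℕ._< ℓ) (sym (toℕ-anchorˡ i)) (toℕ<n i)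

  part-anchorʳ : ∀ i → part (anchorʳ i) ≡ i
  part-anchorʳ i = toℕ-injective (ℕ.+-cancelʳ-≡ _ _ _ (begin
    toℕ (part (anchorʳ i)) + (N ∸ ℓ) ≡⟨ part-high (anchorʳ i) N∸ℓ≤anchorʳ ⟩
    toℕ (anchorʳ i)                  ≡⟨ toℕ-anchorʳ i ⟩
    N ∸ ℓ + toℕ i                    ≡⟨ ℕ.+-comm (N ∸ ℓ) (toℕ i) ⟩
    toℕ i + (N ∸ ℓ)                  ∎))
    where
    open ≡-Reasoning
    N∸ℓ≤anchorʳ : N ∸ ℓ ≤ toℕ (anchorʳ i)
    N∸ℓ≤anchorʳ = subst (N ∸ ℓ ≤_) (sym (toℕ-anchorʳ i)) (ℕ.m≤m+n (N ∸ ℓ) (toℕ i))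

  -- Γ compares only adjacent parts directly; chain through the left anchors of the parts between.
  <-part⇒<-σ : ∀ {a b} → part a < part b → σ a < σ b
  <-part⇒<-σ {a} {b} pa<pb = let gap , gap-eq = ℕ.m≤n⇒∃[o]m+o≡n pa<pb in climb gap a gap-eq
    where
    climb : ∀ d a → suc (toℕ (part a)) + d ≡ toℕ (part b) → σ a < σ b
    climb zero    a eq = adjacent-parts a b (trans (sym eq) (ℕ.+-identityʳ _))
    climb (suc d) a eq = <-trans (adjacent-parts a next part-next) (climb d next next-eq)
      where
      next< : suc (toℕ (part a)) ℕ.< ℓ
      next< = ℕ.<-trans (subst (suc (toℕ (part a)) ℕ.<_) eq (ℕ.m<m+n _ ℕ.z<s)) (toℕ<n (part b))
      next : Fin N
      next = anchorˡ (fromℕ< next<)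
      part-next : toℕ (part next) ≡ suc (toℕ (part a))
      part-next = trans (cong toℕ (part-anchorˡ (fromℕ< next<))) (toℕ-fromℕ< next<)
      next-eq : suc (toℕ (part next)) + d ≡ toℕ (part b)
      next-eq = trans (cong (λ x → suc x + d) part-next) (trans (sym (ℕ.+-suc _ d)) eq)

  <-σ⇔precedes : ∀ a b → (σ a < σ b → Precedes part a b) × (Precedes part a b → σ a < σ b)
  <-σ⇔precedes a b = to , from
    where
    to : σ a < σ b → Precedes part a b
    to σa<σb with <-cmp (part a) (part b)
    ... | tri< pa<pb _ _ = inj₁ pa<pb
    ... | tri> _ _ pb<pa = contradiction (<-part⇒<-σ pb<pa) (<-asym σa<σb)
    ... | tri≈ _ pa≡pb _ with <-cmp a b
    ...   | tri< a<b _ _ = contradiction (decreasing-within-part pa≡pb a<b) (<-asym σa<σb)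
    ...   | tri≈ _ refl _ = contradiction σa<σb (<-irrefl refl)
    ...   | tri> _ _ b<a = inj₂ (pa≡pb , b<a)

    from : Precedes part a b → σ a < σ b
    from (inj₁ pa<pb)         = <-part⇒<-σ pa<pb
    from (inj₂ (pa≡pb , b<a)) = decreasing-within-part (sym pa≡pb) b<a

  ascending-if-<-part : ∀ {a b} → a < b → part a < part b → Ascending σ a b
  ascending-if-<-part a<b pa<pb = a<b , <-part⇒<-σ pa<pb

  anchorˡ-ascending : ∀ {i j} → i < j → Ascending σ (anchorˡ i) (anchorˡ j)
  anchorˡ-ascending {i} {j} i<j = ascending-if-<-part
    (subst₂ ℕ._<_ (sym (toℕ-anchorˡ i)) (sym (toℕ-anchorˡ j)) i<j)
    (subst₂ _<_ (sym (part-anchorˡ i)) (sym (part-anchorˡ j)) i<j)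

  anchorˡ<-if-<-part : ∀ {j r} → j < part r → anchorˡ j < r
  anchorˡ<-if-<-part {j} {r} j<pr = subst (ℕ._< toℕ r) (sym (toℕ-anchorˡ j)) j<r
    where
    j<r : toℕ j ℕ.< toℕ r
    j<r with toℕ r ℕ.<? ℓ
    ... | yes r<ℓ = subst (toℕ j ℕ.<_) (part-low r r<ℓ) j<pr
    ... | no  r≮ℓ = ℕ.<-≤-trans (toℕ<n j) (ℕ.≮⇒≥ r≮ℓ)

  <-anchorʳ-if-<-part : ∀ {j r} → part r < j → r < anchorʳ j
  <-anchorʳ-if-<-part {j} {r} pr<j = subst (toℕ r ℕ.<_) (sym (toℕ-anchorʳ j)) r<j
    where
    r<j : toℕ r ℕ.< N ∸ ℓ + toℕ j
    r<j with N ∸ ℓ ℕ.≤? toℕ r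
    ... | yes N∸ℓ≤r = subst₂ ℕ._<_ (part-high r N∸ℓ≤r) (ℕ.+-comm (toℕ j) (N ∸ ℓ))
                             (ℕ.+-monoˡ-< (N ∸ ℓ) pr<j)
    ... | no  N∸ℓ≰r = ℕ.<-≤-trans (ℕ.≰⇒> N∸ℓ≰r) (ℕ.m≤m+n (N ∸ ℓ) (toℕ j))

  transversal : Fin N → Fin ℓ → Fin N
  transversal r j with <-cmp j (part r)
  ... | tri< _ _ _ = anchorˡ j
  ... | tri≈ _ _ _ = r
  ... | tri> _ _ _ = anchorʳ j

  part-transversal : ∀ r j → part (transversal r j) ≡ j
  part-transversal r j with <-cmp j (part r)
  ... | tri< _ _ _    = part-anchorˡ j
  ... | tri≈ _ j≡pr _ = sym j≡pr
  ... | tri> _ _ _    = part-anchorʳ j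

  transversal-self : ∀ r → transversal r (part r) ≡ r
  transversal-self r with <-cmp (part r) (part r)
  ... | tri< pr<pr _ _ = contradiction pr<pr (<-irrefl refl)
  ... | tri≈ _ _ _     = refl
  ... | tri> _ _ pr<pr = contradiction pr<pr (<-irrefl refl)

  transversal-< : ∀ r {j j'} → j < j' → transversal r j < transversal r j'
  transversal-< r {j} {j'} j<j' with <-cmp j (part r) | <-cmp j' (part r)
  ... | tri< _ _ _    | tri< _ _ _     =
    subst₂ ℕ._<_ (sym (toℕ-anchorˡ j)) (sym (toℕ-anchorˡ j')) j<j'
  ... | tri< j<pr _ _ | tri≈ _ _ _     = anchorˡ<-if-<-part j<pr
  ... | tri< _ _ _    | tri> _ _ _     = anchorˡ<anchorʳ j j'
  ... | tri≈ _ refl _ | tri< j'<pr _ _ = contradiction (<-trans j<j' j'<pr) (<-irrefl refl)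
  ... | tri≈ _ refl _ | tri≈ _ j'≡pr _ = contradiction j<j' (<-irrefl (sym j'≡pr))
  ... | tri≈ _ _ _    | tri> _ _ pr<j' = <-anchorʳ-if-<-part pr<j'
  ... | tri> _ _ pr<j | tri< j'<pr _ _ = contradiction (<-trans pr<j j<j') (<-asym j'<pr)
  ... | tri> _ _ pr<j | tri≈ _ refl _  = contradiction (<-trans pr<j j<j') (<-irrefl refl)
  ... | tri> _ _ _    | tri> _ _ _     =
    subst₂ ℕ._<_ (sym (toℕ-anchorʳ j)) (sym (toℕ-anchorʳ j')) (ℕ.+-monoʳ-< (N ∸ ℓ) j<j')

  transversal-ascending : ∀ r {j j'} → j < j' → Ascending σ (transversal r j) (transversal r j')
  transversal-ascending r {j} {j'} j<j' = ascending-if-<-part (transversal-< r j<j')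
    (subst₂ _<_ (sym (part-transversal r j)) (sym (part-transversal r j')) j<j')

  anchorˡ-separated-transversal : ∀ r {j} → j ≢ part r →
                                  Separated σ (anchorˡ (part r)) (transversal r j)
  anchorˡ-separated-transversal r {j} j≢pr with <-cmp j (part r)
  ... | tri< j<pr _ _ = inj₂ (anchorˡ-ascending j<pr)
  ... | tri≈ _ j≡pr _ = contradiction j≡pr j≢pr
  ... | tri> _ _ pr<j = inj₁ (ascending-if-<-part (anchorˡ<anchorʳ (part r) j)
    (subst₂ _<_ (sym (part-anchorˡ (part r))) (sym (part-anchorʳ j)) pr<j))

precedes-cong : ∀ {N ℓ} {p p' : Fin N → Fin ℓ} → p ≗ p' → ∀ {a b} → Precedes p a b → Precedes p' a b
precedes-cong p≗p' {a} {b} (inj₁ pa<pb)         = inj₁ (subst₂ _<_ (p≗p' a) (p≗p' b) pa<pb)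
precedes-cong p≗p' {a} {b} (inj₂ (pa≡pb , b<a)) =
  inj₂ (trans (sym (p≗p' a)) (trans pa≡pb (p≗p' b)) , b<a)

Γ-unique : ∀ {N ℓ} {σ σ' : Fin N → Fin N} (ℓ+ℓ≤N : ℓ + ℓ ≤ N) (γ : InΓ N ℓ σ) (γ' : InΓ N ℓ σ') →
           Γ-properties.part ℓ+ℓ≤N γ ≗ Γ-properties.part ℓ+ℓ≤N γ' → σ ≗ σ'
Γ-unique ℓ+ℓ≤N γ γ' same-parts = same-order⇒≗ (proj₁ γ) (proj₁ γ')
  (λ {a b} → proj₂ (Γ'.<-σ⇔precedes a b) ∘ precedes-cong same-parts
                                          ∘ proj₁ (Γ.<-σ⇔precedes a b))
  (λ {a b} → proj₂ (Γ.<-σ⇔precedes a b) ∘ precedes-cong (sym ∘ same-parts)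
                                         ∘ proj₁ (Γ'.<-σ⇔precedes a b))
  where
  module Γ  = Γ-properties ℓ+ℓ≤N γ
  module Γ' = Γ-properties ℓ+ℓ≤N γ'

-- combine s r is position s * M + r, the r-th entry of block s.
record Blocked (k M q : ℕ) (π : Fin (q * M) → Fin (q * M)) : Set where
  field
    σ         : Fin q → Fin M → Fin M
    σ-Γ       : ∀ s → InΓ M k (σ s)
    π-combine : ∀ s r → π (combine s r) ≡ combine s (σ s r)

InU⇒Blocked : ∀ {k q} {π : Fin (q * (3 * k ∸ 3)) → Fin (q * (3 * k ∸ 3))} →
              0 ℕ.< 3 * k ∸ 3 → InU k (q * (3 * k ∸ 3)) π → Blocked k (3 * k ∸ 3) q π
InU⇒Blocked {k} {q} {π} 0<M (_ , σ , σ-Γ , π-value) = record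
  { σ         = σ ∘ toℕ
  ; σ-Γ       = λ s → σ-Γ (toℕ s) (ℕ.*-monoˡ-< M {{ℕ.>-nonZero 0<M}} (toℕ<n s))
  ; π-combine = λ s r → toℕ-injective (π-combine s r)
  }
  where
  M : ℕ
  M = 3 * k ∸ 3
  open ≡-Reasoning

  π-combine : ∀ s r → toℕ (π (combine s r)) ≡ toℕ (combine s (σ (toℕ s) r))
  π-combine s r = begin
    toℕ (π (combine s r))        ≡⟨ cong (toℕ ∘ π) combine≡fromℕ< ⟩
    toℕ (π (fromℕ< in-range))    ≡⟨ π-value (toℕ s) r in-range ⟩
    toℕ s * M + toℕ (σ (toℕ s) r) ≡⟨ toℕ-combine′ s (σ (toℕ s) r) ⟨
    toℕ (combine s (σ (toℕ s) r)) ∎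
    where
    in-range : toℕ s * M + toℕ r ℕ.< q * M
    in-range = subst (ℕ._< q * M) (toℕ-combine′ s r) (toℕ<n (combine s r))
    combine≡fromℕ< : combine s r ≡ fromℕ< in-range
    combine≡fromℕ< = toℕ-injective (trans (toℕ-combine′ s r) (sym (toℕ-fromℕ< in-range)))

module Blocks {k M q : ℕ} (k+k≤M : k + k ≤ M) {π : Fin (q * M) → Fin (q * M)}
              (B : Blocked k M q π) where
  open Blocked B
  open Anchors {M} {k} k+k≤M
  module Block (s : Fin q) = Γ-properties k+k≤M (σ-Γ s)
  open Block public using (part; part-anchorˡ)

  ascending-across-blocks : ∀ {s s'} r r' → s < s' → Ascending π (combine s r) (combine s' r')
  ascending-across-blocks {s} {s'} r r' s<s' = combine-monoˡ-< r r' s<s' ,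
    subst₂ _<_ (sym (π-combine s r)) (sym (π-combine s' r')) (combine-monoˡ-< _ _ s<s')

  separated-across-blocks : ∀ {s s'} r r' → s ≢ s' → Separated π (combine s r) (combine s' r')
  separated-across-blocks {s} {s'} r r' s≢s' with <-cmp s s'
  ... | tri< s<s' _ _ = inj₁ (ascending-across-blocks r r' s<s')
  ... | tri≈ _ s≡s' _ = contradiction s≡s' s≢s'
  ... | tri> _ _ s'<s = inj₂ (ascending-across-blocks r' r s'<s)

  ascending-within-block : ∀ s {r r'} → Ascending (σ s) r r' →
                           Ascending π (combine s r) (combine s r')
  ascending-within-block s {r} {r'} (r<r' , σr<σr') = combine-monoʳ-< s r<r' ,
    subst₂ _<_ (sym (π-combine s r)) (sym (π-combine s r')) (combine-monoʳ-< s σr<σr')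

  separated-within-block : ∀ s {r r'} → Separated (σ s) r r' →
                           Separated π (combine s r) (combine s r')
  separated-within-block s = Sum.map (ascending-within-block s) (ascending-within-block s)

  canonical : Fin (q * M) → Fin (k * q)
  canonical a = uncurry (λ s r → combine (part s r) s) (remQuot M a)

  canonical-combine : ∀ s r → canonical (combine s r) ≡ combine (part s r) s
  canonical-combine s r = cong (uncurry (λ s r → combine (part s r) s)) (remQuot-combine s r)

  canonical-decPartition : DecPartition (k * q) π canonical
  canonical-decPartition = surjective , decreasing
    where
    surjective : Surj canonical
    surjective y with combine-surjective {k} {q} y
    ... | i , s , refl = combine s (anchorˡ i) ,
      trans (canonical-combine s (anchorˡ i)) (cong (λ j → combine j s) (part-anchorˡ s i))

    decreasing : ∀ a b → a < b → canonical a ≡ canonical b → π b < π a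
    decreasing a b a<b same with combine-surjective {q} {M} a | combine-surjective {q} {M} b
    ... | s , r , refl | s' , r' , refl
      with combine-injective (part s r) s (part s' r') s'
             (trans (sym (canonical-combine s r)) (trans same (canonical-combine s' r')))
    ...   | same-part , refl = subst₂ _<_ (sym (π-combine s r')) (sym (π-combine s r))
      (combine-monoʳ-< s (Block.decreasing-within-part s same-part (combine-cancelˡ-< s a<b)))

  module Classes {c : Fin (q * M) → Fin (k * q)} (dp : DecPartition (k * q) π c) where

    same-class⇒same-block : ∀ {s s'} r r' → c (combine s r) ≡ c (combine s' r') → s ≡ s'
    same-class⇒same-block {s} {s'} r r' same with s ≟ s'
    ... | yes s≡s' = s≡s'
    ... | no  s≢s' =
      contradiction same (separated⇒different-classes dp (separated-across-blocks r r' s≢s'))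

    anchorˡ-classes-injective : ∀ s {i j} → c (combine s (anchorˡ i)) ≡ c (combine s (anchorˡ j)) →
                                i ≡ j
    anchorˡ-classes-injective s = classes-of-separated-family-injective dp
      (separated-within-block s ∘ ascending⇒separated {π = σ s} (Block.anchorˡ-ascending s))

    transversals : Fin M → Fin q × Fin k → Fin (q * M)
    transversals r (t , j) = combine t (Block.transversal t r j)

    transversals-separated : ∀ r {u v} → u ≢ v → Separated π (transversals r u) (transversals r v)
    transversals-separated r {t , j} {t' , j'} u≢v with t ≟ t'
    ... | no  t≢t' = separated-across-blocks _ _ t≢t'
    ... | yes refl = separated-within-block t
      (ascending⇒separated {π = σ t} (Block.transversal-ascending t r) (u≢v ∘ cong (t ,_)))

    anchorˡ-separated-transversals : ∀ s r {u} → u ≢ (s , part s r) →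
      Separated π (combine s (anchorˡ (part s r))) (transversals r u)
    anchorˡ-separated-transversals s r {t , j} u≢ with s ≟ t
    ... | no  s≢t  = separated-across-blocks _ _ s≢t
    ... | yes refl = separated-within-block s
      (Block.anchorˡ-separated-transversal s r (u≢ ∘ cong (s ,_)))

    class-anchorˡ : ∀ s r → c (combine s r) ≡ c (combine s (anchorˡ (part s r)))
    class-anchorˡ s r = begin
      c (combine s r)                         ≡⟨ cong (c ∘ combine s) (Block.transversal-self s r) ⟨
      c (combine s (Block.transversal s r i)) ≡⟨ cong (c ∘ transversals r) (remQuot-combine s i) ⟨
      c (L (combine s i))                     ≡⟨ anchor-in-class-of-L ⟨
      c (combine s (anchorˡ i))               ∎
      where
      open ≡-Reasoning
      i : Fin k
      i = part s r

      L : Fin (q * k) → Fin (q * M)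
      L = transversals r ∘ remQuot k

      L-separated : ∀ {z z'} → z ≢ z' → Separated π (L z) (L z')
      L-separated z≢z' = transversals-separated r (z≢z' ∘ remQuot-injective k)

      anchor-separated : ∀ z → z ≢ combine s i → Separated π (combine s (anchorˡ i)) (L z)
      anchor-separated z z≢ = anchorˡ-separated-transversals s r
        (λ eq → z≢ (remQuot-injective k (trans eq (sym (remQuot-combine s i)))))

      anchor-in-class-of-L : c (combine s (anchorˡ i)) ≡ c (L (combine s i))
      anchor-in-class-of-L = class-of-point-separated-from-family dp L-separated
        (ℕ.≤-reflexive (ℕ.*-comm k q)) _ (combine s i) anchor-separated

    same-class⇒same-part : ∀ {s s'} r r' → c (combine s r) ≡ c (combine s' r') →
                           s ≡ s' × part s r ≡ part s' r'
    same-class⇒same-part {s} r r' same with same-class⇒same-block r r' same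
    ... | refl = refl , anchorˡ-classes-injective s
      (trans (sym (class-anchorˡ s r)) (trans same (class-anchorˡ s r')))

    same-part⇒same-class : ∀ {s s'} r r' → s ≡ s' → part s r ≡ part s' r' →
                           c (combine s r) ≡ c (combine s' r')
    same-part⇒same-class {s} r r' refl same-part = trans (class-anchorˡ s r)
      (trans (cong (λ i → c (combine s (anchorˡ i))) same-part) (sym (class-anchorˡ s r')))

  decPartitions-agree : ∀ {c c'} → DecPartition (k * q) π c → DecPartition (k * q) π c' →
                        SamePartition c c'
  decPartitions-agree dp dp' a b with combine-surjective {q} {M} a | combine-surjective {q} {M} b
  ... | s , r , refl | s' , r' , refl = transfer dp dp' , transfer dp' dp
    where
    transfer : ∀ {c c'} → DecPartition (k * q) π c → DecPartition (k * q) π c' →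
               c (combine s r) ≡ c (combine s' r') → c' (combine s r) ≡ c' (combine s' r')
    transfer dp dp' = uncurry (Classes.same-part⇒same-class dp' r r')
                    ∘ Classes.same-class⇒same-part dp r r'

module _ {k M q : ℕ} (k+k≤M : k + k ≤ M) {π π' : Fin (q * M) → Fin (q * M)}
         (B : Blocked k M q π) (B' : Blocked k M q π') where
  private
    module P  = Blocks k+k≤M B
    module P' = Blocks k+k≤M B'
    open Anchors {M} {k} k+k≤M

  same-partition⇒same-parts : ∀ {c c'} → DecPartition (k * q) π c → DecPartition (k * q) π' c' →
                              SamePartition c c' → ∀ s → P.part s ≗ P'.part s
  same-partition⇒same-parts {c' = c'} dp dp' same s r = begin
    P.part s r            ≡⟨ P'.part-anchorˡ s i ⟨
    P'.part s (anchorˡ i) ≡⟨ proj₂ (P'.Classes.same-class⇒same-part dp' r (anchorˡ i) same-class′) ⟨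
    P'.part s r           ∎
    where
    open ≡-Reasoning
    i : Fin k
    i = P.part s r
    same-class′ : c' (combine s r) ≡ c' (combine s (anchorˡ i))
    same-class′ = proj₁ (same _ _) (P.Classes.class-anchorˡ dp s r)

  same-partition⇒≗ : ∀ {c c'} → DecPartition (k * q) π c → DecPartition (k * q) π' c' →
                     SamePartition c c' → π ≗ π'
  same-partition⇒≗ dp dp' same a with combine-surjective {q} {M} a
  ... | s , r , refl = begin
    π (combine s r)                   ≡⟨ Blocked.π-combine B s r ⟩
    combine s (Blocked.σ B s r)       ≡⟨ cong (combine s) σ≗σ' ⟩
    combine s (Blocked.σ B' s r)      ≡⟨ Blocked.π-combine B' s r ⟨
    π' (combine s r)                  ∎
    where
    open ≡-Reasoning
    σ≗σ' : Blocked.σ B s r ≡ Blocked.σ B' s r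
    σ≗σ' = Γ-unique k+k≤M (Blocked.σ-Γ B s) (Blocked.σ-Γ B' s)
                    (same-partition⇒same-parts dp dp' same s) r

k+k≤3k∸3 : ∀ {k} → 3 ≤ k → k + k ≤ 3 * k ∸ 3
k+k≤3k∸3 {k} 3≤k = ℕ.m+n≤o⇒m≤o∸n (k + k)
  (subst (k + k + 3 ≤_) k+k+k≡3k (ℕ.+-monoʳ-≤ (k + k) 3≤k))
  where
  k+k+k≡3k : k + k + k ≡ 3 * k
  k+k+k≡3k = trans (ℕ.+-assoc k k k) (cong (λ x → k + (k + x)) (sym (ℕ.+-identityʳ k)))

proposition24 : (k n : ℕ) → 4 ≤ k → 3 * k ≤ n → (d : (3 * k ∸ 3) ∣ n) →
  ((π : Fin n → Fin n) → InU k n π →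
    (∃ λ (c : Fin n → Fin (k * _∣_.quotient d)) → DecPartition (k * _∣_.quotient d) π c) ×
    ((c c' : Fin n → Fin (k * _∣_.quotient d)) →
      DecPartition (k * _∣_.quotient d) π c → DecPartition (k * _∣_.quotient d) π c' →
      SamePartition c c')) ×
  ((π π' : Fin n → Fin n) → InU k n π → InU k n π' → ¬ (∀ i → π i ≡ π' i) →
    (c c' : Fin n → Fin (k * _∣_.quotient d)) →
    DecPartition (k * _∣_.quotient d) π c → DecPartition (k * _∣_.quotient d) π' c' →
    ¬ SamePartition c c')
proposition24 k _ 4≤k _ (divides q refl) =
  (λ π U → let open Blocks {k} k+k≤M (blocked U) in
    (canonical , canonical-decPartition) , λ _ _ → decPartitions-agree) ,
  (λ π π' U U' π≢π' _ _ dp dp' same →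
    π≢π' (same-partition⇒≗ {k} k+k≤M (blocked U) (blocked U') dp dp' same))
  where
  k+k≤M : k + k ≤ 3 * k ∸ 3
  k+k≤M = k+k≤3k∸3 (ℕ.≤-trans (ℕ.n≤1+n 3) 4≤k)

  0<M : 0 ℕ.< 3 * k ∸ 3
  0<M = ℕ.<-≤-trans (ℕ.<-≤-trans ℕ.z<s 4≤k) (ℕ.≤-trans (ℕ.m≤m+n k k) k+k≤M)

  blocked : ∀ {π} → InU k (q * (3 * k ∸ 3)) π → Blocked k (3 * k ∸ 3) q π
  blocked = InU⇒Blocked 0<M
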